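{- Let $\mathcal{S}$ be a move sequence. The rank of the set $\{\mathrm{imprv}_{\tau_0,\mathcal{S}}(\alpha):\alpha \text{ an arc of } \mathcal{S}\}$ is the same for every choice of $\tau_0\in\{\pm1\}^{V(\mathcal{S})}$.
   Context: $V_n=[n]$, $K_n=(V_n,E_n)$ complete graph. A move sequence is $\mathcal{S}=(\mathcal{S}_1,\dots,\mathcal{S}_\ell)$ with each $\mathcal{S}_i\subseteq V_n$ of size 1 or 2; $V(\mathcal{S})$ is the set of nodes occurring in it and $E(\mathcal{S})$ the set of edges with both endpoints in $V(\mathcal{S})$. For $\tau_0\in\{\pm1\}^{V(\mathcal{S})}$, $\tau_i$ is obtained from $\tau_{i-1}$ by flipping the nodes of $\mathcal{S}_i$. $\mathrm{imprv}_{\tau_0,\mathcal{S}}(i)\in\{0,\pm1\}^{E(\mathcal{S})}$: if $\mathcal{S}_i=\{u\}$, its entry at $\{u,w\}$ is $\tau_{i-1}(u)\tau_{i-1}(w)$ and other entries are 0; if $\mathcal{S}_i=\{u,v\}$, its entry at $\{u,w\}$ ($w\notin\{u,v\}$) is $\tau_{i-1}(u)\tau_{i-1}(w)$, at $\{v,w\}$ ($w\notin\{u,v\}$) is $\tau_{i-1}(v)\tau_{i-1}(w)$, others 0. An arc is a pair $\alpha=(i,j)$, $i<j$, with $\mathcal{S}_i=\mathcal{S}_j=\{u\}$ and $\mathcal{S}_k\neq\{u\}$ for $i<k<j$; $\mathrm{imprv}_{\tau_0,\mathcal{S}}(\alpha)=\tau_i(u)\mathrm{imprv}_{\tau_0,\mathcal{S}}(i)-\tau_j(u)\mathrm{imprv}_{\tau_0,\mathcal{S}}(j)$.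 -}

module Defs where

open import Data.Nat as ℕ using (ℕ; zero; suc)
open import Data.Fin as F using (Fin; toℕ)
open import Data.Fin.Properties using (any?) renaming (_≟_ to _≟ᶠ_)
open import Data.Sign as Sign using (Sign)
open import Data.Rational as ℚ using (ℚ; 0ℚ; 1ℚ)
open import Data.List as L using (List; []; _∷_; length; lookup; take; foldl; foldr; zipWith; map)
open import Data.List.Relation.Unary.All using (All)
open import Data.Product using (Σ; ∃; _×_; _,_)
open import Data.Sum using (_⊎_)
open import Data.Bool using (Bool; true; false; if_then_else_; _xor_)
open import Relation.Nullary using (¬_; Dec; yes; no; does)
open import Relation.Nullary.Decidable using (_⊎-dec_)
open import Relation.Binary.PropositionalEquality using (_≡_; _≢_)

-- A move: a subset of V_n = Fin n of size 1 or 2.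
-- (double u v) represents the 2-set {u,v}; all notions below are symmetric in u,v.
data Move (n : ℕ) : Set where
  single : Fin n → Move n
  double : (u v : Fin n) → u ≢ v → Move n

_∈ₘ_ : {n : ℕ} → Fin n → Move n → Set
w ∈ₘ single u     = w ≡ u
w ∈ₘ double u v _ = w ≡ u ⊎ w ≡ v

_∈ₘ?_ : {n : ℕ} (w : Fin n) (m : Move n) → Dec (w ∈ₘ m)
w ∈ₘ? single u     = w ≟ᶠ u
w ∈ₘ? double u v _ = (w ≟ᶠ u) ⊎-dec (w ≟ᶠ v)

-- a move sequence S = (S_1,...,S_ℓ) is a list; position i : Fin (length S)
-- corresponds to S_{i+1} of the paper.
MoveSeq : ℕ → Set
MoveSeq n = List (Move n)

_∈V_ : {n : ℕ} → Fin n → MoveSeq n → Set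
w ∈V S = ∃ λ (i : Fin (length S)) → w ∈ₘ lookup S i

_∈V?_ : {n : ℕ} (w : Fin n) (S : MoveSeq n) → Dec (w ∈V S)
w ∈V? S = any? (λ i → w ∈ₘ? lookup S i)

Edge : ℕ → Set
Edge n = Σ (Fin n × Fin n) λ { (a , b) → a F.< b }

-- configurations (only the values on V(S) are ever used)
Config : ℕ → Set
Config n = Fin n → Sign

flipMove : {n : ℕ} → Move n → Config n → Config n
flipMove m τ w = if does (w ∈ₘ? m) then Sign.opposite (τ w) else τ w

state : {n : ℕ} → Config n → MoveSeq n → ℕ → Config n
state τ₀ S k = foldl (λ τ m → flipMove m τ) τ₀ (take k S)

sgn : Sign → ℚ
sgn Sign.+ = 1ℚ
sgn Sign.- = ℚ.- 1ℚ

-- imprv_{τ0,S}(i) as a vector in ℚ^{edges}; entries outside E(S) are 0.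
-- For i : Fin (length S) (paper's index i+1) it uses τ_{toℕ i} (paper's τ_{i}).
-- At an edge {a,b} ⊆ V(S): τ(a)τ(b) if exactly one of a,b lies in the move
-- (this is the paper's {u,w} with w ∉ S_i), and 0 otherwise.
imprv : {n : ℕ} → Config n → (S : MoveSeq n) → Fin (length S) → Edge n → ℚ
imprv τ₀ S i ((a , b) , _) with a ∈V? S | b ∈V? S
... | yes _ | yes _ =
  if does (a ∈ₘ? lookup S i) xor does (b ∈ₘ? lookup S i)
  then sgn (τ a) ℚ.* sgn (τ b) else 0ℚ
  where τ = state τ₀ S (toℕ i)
... | _ | _ = 0ℚ

record Arc {n : ℕ} (S : MoveSeq n) : Set where
  constructor arc
  field
    i j  : Fin (length S)
    i<j  : i F.< j
    u    : Fin n
    Si   : lookup S i ≡ single u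
    Sj   : lookup S j ≡ single u
    gap  : ∀ (k : Fin (length S)) → i F.< k → k F.< j → lookup S k ≢ single u

-- imprv(α) = τ_i(u) imprv(i) − τ_j(u) imprv(j)  (paper indexing; here
-- τ_i in the paper's sense is the state after toℕ i + 1 moves)
imprvArc : {n : ℕ} → Config n → (S : MoveSeq n) → Arc S → Edge n → ℚ
imprvArc τ₀ S α e =
  (sgn (state τ₀ S (suc (toℕ i)) u) ℚ.* imprv τ₀ S i e)
  ℚ.- (sgn (state τ₀ S (suc (toℕ j)) u) ℚ.* imprv τ₀ S j e)
  where open Arc α

sumℚ : List ℚ → ℚ
sumℚ = foldr ℚ._+_ 0ℚ

linComb : {n : ℕ} → List ℚ → List (Edge n → ℚ) → Edge n → ℚ
linComb cs vs e = sumℚ (zipWith (λ c v → c ℚ.* v e) cs vs)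

LinIndep : {n : ℕ} {I : Set} → (I → Edge n → ℚ) → List I → Set
LinIndep v xs = ∀ (cs : List ℚ) → length cs ≡ length xs →
  (∀ e → linComb cs (map v xs) e ≡ 0ℚ) → All (_≡ 0ℚ) cs

-- the family (v x)_{x : I} (equivalently the set {v x}) has rank r:
-- maximal size of a linearly independent subfamily is r
HasRank : {n : ℕ} {I : Set} → (I → Edge n → ℚ) → ℕ → Set
HasRank {I = I} v r =
  (Σ (List I) λ xs → length xs ≡ r × LinIndep v xs)
  × (∀ (xs : List I) → LinIndep v xs → length xs ℕ.≤ r)

-- Put ρ w = τ₀(w) τ₀′(w). Flipping commutes with multiplying a configuration
-- pointwise by ρ, so every intermediate configuration of the run from τ₀′ is ρ
-- times the one from τ₀. Hence imprv(i) changes by the diagonal sign matrix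
-- e = {a,b} ↦ ρ(a)ρ(b) on the edge space, and imprv(α) of an arc at u is further
-- multiplied by ρ(u). An invertible diagonal change of coordinates together with
-- a rescaling of each vector by a unit preserves linear independence, hence rank.
module Submission where

open import Defs
open import Data.Nat using (ℕ; suc)
open import Data.Nat.Properties using (suc-injective)
open import Data.Fin using (Fin; toℕ)
open import Data.Sign as Sign using (Sign; opposite)
open import Data.Sign.Properties using (s*s≡+)
open import Data.Rational using (ℚ; 0ℚ; 1ℚ; _+_; _*_; _-_)
open import Data.Rational.Properties
  using (+-*-commutativeRing; *-zeroʳ; *-identityˡ; *-assoc; *-comm)
open import Data.List using (List; []; _∷_; length; lookup; take; foldl; zipWith; map)
open import Data.List.Relation.Unary.All using (All; []; _∷_)
open import Data.Product using (_,_)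
open import Data.Bool using (true; false; _xor_)
open import Data.Maybe using (nothing)
open import Level using (0ℓ)
open import Relation.Nullary using (yes; no; does)
open import Relation.Binary.PropositionalEquality
open import Tactic.RingSolver using (solve-∀)
open import Tactic.RingSolver.Core.AlmostCommutativeRing
  using (AlmostCommutativeRing; fromCommutativeRing)

ℚ-ring : AlmostCommutativeRing 0ℓ 0ℓ
ℚ-ring = fromCommutativeRing +-*-commutativeRing (λ _ → nothing)

unit*u≡0⇒u≡0 : ∀ {u : ℚ} (k k⁻¹ : ℚ) → k⁻¹ * k ≡ 1ℚ → k * u ≡ 0ℚ → u ≡ 0ℚ
unit*u≡0⇒u≡0 {u} k k⁻¹ k⁻¹*k≡1 k*u≡0 = begin
  u               ≡⟨ sym (*-identityˡ u) ⟩
  1ℚ * u          ≡⟨ cong (_* u) (sym k⁻¹*k≡1) ⟩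
  k⁻¹ * k * u     ≡⟨ *-assoc k⁻¹ k u ⟩
  k⁻¹ * (k * u)   ≡⟨ cong (k⁻¹ *_) k*u≡0 ⟩
  k⁻¹ * 0ℚ        ≡⟨ *-zeroʳ k⁻¹ ⟩
  0ℚ              ∎
  where open ≡-Reasoning

module _ {n : ℕ} {I : Set} (v w : I → Edge n → ℚ) (c : I → ℚ) (d : Edge n → ℚ)
         (w≡cdv : ∀ x e → w x e ≡ c x * (d e * v x e)) where

  scale : List ℚ → List I → List ℚ
  scale = zipWith (λ a x → a * c x)

  linComb-rescale : ∀ cs xs e →
    linComb cs (map w xs) e ≡ d e * linComb (scale cs xs) (map v xs) e
  linComb-rescale []       _        e = sym (*-zeroʳ (d e))
  linComb-rescale (_ ∷ _)  []       e = sym (*-zeroʳ (d e))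
  linComb-rescale (a ∷ cs) (x ∷ xs) e = begin
    a * w x e + linComb cs (map w xs) e
      ≡⟨ cong₂ (λ p q → a * p + q) (w≡cdv x e) (linComb-rescale cs xs e) ⟩
    a * (c x * (d e * v x e)) + d e * linComb (scale cs xs) (map v xs) e
      ≡⟨ regroup a (c x) (d e) (v x e) _ ⟩
    d e * (a * c x * v x e + linComb (scale cs xs) (map v xs) e)
      ∎
    where
    open ≡-Reasoning
    regroup : ∀ (a c d u r : ℚ) → a * (c * (d * u)) + d * r ≡ d * (a * c * u + r)
    regroup = solve-∀ ℚ-ring

  length-scale : ∀ cs xs → length cs ≡ length xs → length (scale cs xs) ≡ length xs
  length-scale []       []       _  = refl
  length-scale (_ ∷ cs) (_ ∷ xs) eq = cong suc (length-scale cs xs (suc-injective eq))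

  module _ (c⁻¹ : I → ℚ) (c⁻¹*c≡1 : ∀ x → c⁻¹ x * c x ≡ 1ℚ)
           (d⁻¹ : Edge n → ℚ) (d⁻¹*d≡1 : ∀ e → d⁻¹ e * d e ≡ 1ℚ) where

    unscale-zeros : ∀ cs xs → length cs ≡ length xs →
      All (_≡ 0ℚ) (scale cs xs) → All (_≡ 0ℚ) cs
    unscale-zeros []       []       _  []         = []
    unscale-zeros (a ∷ cs) (x ∷ xs) eq (ac≡0 ∷ zs) =
      unit*u≡0⇒u≡0 (c x) (c⁻¹ x) (c⁻¹*c≡1 x) (trans (*-comm (c x) a) ac≡0)
      ∷ unscale-zeros cs xs (suc-injective eq) zs

    LinIndep-rescale : ∀ xs → LinIndep v xs → LinIndep w xs
    LinIndep-rescale xs indep cs len w-comb≡0 =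
      unscale-zeros cs xs len
        (indep (scale cs xs) (length-scale cs xs len) λ e →
          unit*u≡0⇒u≡0 (d e) (d⁻¹ e) (d⁻¹*d≡1 e)
            (trans (sym (linComb-rescale cs xs e)) (w-comb≡0 e)))

HasRank-resp : ∀ {n} {I : Set} {v w : I → Edge n → ℚ} {r} →
  (∀ xs → LinIndep v xs → LinIndep w xs) →
  (∀ xs → LinIndep w xs → LinIndep v xs) →
  HasRank v r → HasRank w r
HasRank-resp v⇒w w⇒v ((xs , len , indep) , maximal) =
  (xs , len , v⇒w xs indep) , λ ys indep′ → maximal ys (w⇒v ys indep′)

sgn-* : ∀ x y → sgn (x Sign.* y) ≡ sgn x * sgn y
sgn-* Sign.+ Sign.+ = refl
sgn-* Sign.+ Sign.- = refl
sgn-* Sign.- Sign.+ = refl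
sgn-* Sign.- Sign.- = refl

sgn*sgn≡1 : ∀ x → sgn x * sgn x ≡ 1ℚ
sgn*sgn≡1 x = trans (sym (sgn-* x x)) (cong sgn (s*s≡+ x))

opposite-*ʳ : ∀ ρ x → opposite (ρ Sign.* x) ≡ ρ Sign.* opposite x
opposite-*ʳ Sign.+ _ = refl
opposite-*ʳ Sign.- _ = refl

module _ {n : ℕ} (ρ : Fin n → Sign) where

  Twisted : Config n → Config n → Set
  Twisted τ τ′ = ∀ w → τ′ w ≡ ρ w Sign.* τ w

  flipMove-twisted : ∀ m {τ τ′} → Twisted τ τ′ → Twisted (flipMove m τ) (flipMove m τ′)
  flipMove-twisted m {τ} twisted w with does (w ∈ₘ? m)
  ... | true  = trans (cong opposite (twisted w)) (opposite-*ʳ (ρ w) (τ w))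
  ... | false = twisted w

  flipAll-twisted : ∀ ms {τ τ′} → Twisted τ τ′ →
    Twisted (foldl (λ τ m → flipMove m τ) τ ms) (foldl (λ τ m → flipMove m τ) τ′ ms)
  flipAll-twisted []       twisted = twisted
  flipAll-twisted (m ∷ ms) twisted = flipAll-twisted ms (flipMove-twisted m twisted)

  state-twisted : ∀ {τ₀ τ₀′} → Twisted τ₀ τ₀′ → ∀ S k →
    Twisted (state τ₀ S k) (state τ₀′ S k)
  state-twisted twisted S k = flipAll-twisted (take k S) twisted

  edgeSign : Edge n → Sign
  edgeSign ((a , b) , _) = ρ a Sign.* ρ b

  module _ {τ₀ τ₀′ : Config n} (twisted : Twisted τ₀ τ₀′) (S : MoveSeq n) where

    imprv-twisted : ∀ i e → imprv τ₀′ S i e ≡ sgn (edgeSign e) * imprv τ₀ S i e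
    imprv-twisted i ((a , b) , _) with a ∈V? S | b ∈V? S
    ... | no _  | _     = sym (*-zeroʳ (sgn (ρ a Sign.* ρ b)))
    ... | yes _ | no _  = sym (*-zeroʳ (sgn (ρ a Sign.* ρ b)))
    ... | yes _ | yes _ with does (a ∈ₘ? lookup S i) xor does (b ∈ₘ? lookup S i)
    ...   | false = sym (*-zeroʳ (sgn (ρ a Sign.* ρ b)))
    ...   | true  = begin
      sgn (τ′ a) * sgn (τ′ b)
        ≡⟨ cong₂ (λ p q → sgn p * sgn q) (twist a) (twist b) ⟩
      sgn (ρ a Sign.* τ a) * sgn (ρ b Sign.* τ b)
        ≡⟨ cong₂ _*_ (sgn-* (ρ a) (τ a)) (sgn-* (ρ b) (τ b)) ⟩
      (sgn (ρ a) * sgn (τ a)) * (sgn (ρ b) * sgn (τ b))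
        ≡⟨ regroup (sgn (ρ a)) (sgn (τ a)) (sgn (ρ b)) (sgn (τ b)) ⟩
      (sgn (ρ a) * sgn (ρ b)) * (sgn (τ a) * sgn (τ b))
        ≡⟨ cong (_* (sgn (τ a) * sgn (τ b))) (sym (sgn-* (ρ a) (ρ b))) ⟩
      sgn (ρ a Sign.* ρ b) * (sgn (τ a) * sgn (τ b))
        ∎
      where
      open ≡-Reasoning
      τ τ′ : Config n
      τ  = state τ₀ S (toℕ i)
      τ′ = state τ₀′ S (toℕ i)
      twist : Twisted τ τ′
      twist = state-twisted twisted S (toℕ i)
      regroup : ∀ (p x q y : ℚ) → (p * x) * (q * y) ≡ (p * q) * (x * y)
      regroup = solve-∀ ℚ-ring

    imprvArc-twisted : ∀ α e →
      imprvArc τ₀′ S α e ≡ sgn (ρ (Arc.u α)) * (sgn (edgeSign e) * imprvArc τ₀ S α e)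
    imprvArc-twisted α e = begin
      sgn (τ′ᵢ u) * imprv τ₀′ S i e - sgn (τ′ⱼ u) * imprv τ₀′ S j e
        ≡⟨ cong₂ _-_ (cong₂ _*_ (sgn-twist (suc (toℕ i))) (imprv-twisted i e))
                     (cong₂ _*_ (sgn-twist (suc (toℕ j))) (imprv-twisted j e)) ⟩
      (r * sgn (τᵢ u)) * (t * imprv τ₀ S i e) - (r * sgn (τⱼ u)) * (t * imprv τ₀ S j e)
        ≡⟨ regroup r t (sgn (τᵢ u)) (imprv τ₀ S i e) (sgn (τⱼ u)) (imprv τ₀ S j e) ⟩
      r * (t * (sgn (τᵢ u) * imprv τ₀ S i e - sgn (τⱼ u) * imprv τ₀ S j e))
        ∎
      where
      open ≡-Reasoning
      open Arc α
      τᵢ τ′ᵢ τⱼ τ′ⱼ : Config n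
      τᵢ  = state τ₀  S (suc (toℕ i))
      τ′ᵢ = state τ₀′ S (suc (toℕ i))
      τⱼ  = state τ₀  S (suc (toℕ j))
      τ′ⱼ = state τ₀′ S (suc (toℕ j))
      r t : ℚ
      r = sgn (ρ u)
      t = sgn (edgeSign e)
      sgn-twist : ∀ k → sgn (state τ₀′ S k u) ≡ r * sgn (state τ₀ S k u)
      sgn-twist k = trans (cong sgn (state-twisted twisted S k u)) (sgn-* (ρ u) _)
      regroup : ∀ (r t x y x′ y′ : ℚ) →
        (r * x) * (t * y) - (r * x′) * (t * y′) ≡ r * (t * (x * y - x′ * y′))
      regroup = solve-∀ ℚ-ring

product-twists : ∀ {n} (τ₀ τ₀′ : Config n) → Twisted (λ w → τ₀ w Sign.* τ₀′ w) τ₀ τ₀′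
product-twists τ₀ τ₀′ w with τ₀ w | τ₀′ w
... | Sign.+ | Sign.+ = refl
... | Sign.+ | Sign.- = refl
... | Sign.- | Sign.+ = refl
... | Sign.- | Sign.- = refl

imprvArc-LinIndep : ∀ {n} (S : MoveSeq n) (τ₀ τ₀′ : Config n) xs →
  LinIndep (imprvArc τ₀ S) xs → LinIndep (imprvArc τ₀′ S) xs
imprvArc-LinIndep S τ₀ τ₀′ =
  LinIndep-rescale (imprvArc τ₀ S) (imprvArc τ₀′ S) r t
    (imprvArc-twisted ρ (product-twists τ₀ τ₀′) S)
    r (λ α → sgn*sgn≡1 (ρ (Arc.u α)))
    t (λ e → sgn*sgn≡1 (edgeSign ρ e))
  where
  ρ : Fin _ → Sign
  ρ w = τ₀ w Sign.* τ₀′ w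
  r : Arc S → ℚ
  r α = sgn (ρ (Arc.u α))
  t : Edge _ → ℚ
  t e = sgn (edgeSign ρ e)

lemma2p3 : {n : ℕ} (S : MoveSeq n) (τ₀ τ₀′ : Config n) (r : ℕ) →
    HasRank (imprvArc τ₀ S) r → HasRank (imprvArc τ₀′ S) r
lemma2p3 S τ₀ τ₀′ r =
  HasRank-resp (imprvArc-LinIndep S τ₀ τ₀′) (imprvArc-LinIndep S τ₀′ τ₀)
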